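{- For all $n\in\mathbb{N}$, $\pi\in S_n'$ and $2\le i\le\operatorname{sc}(\pi)$, the sequence $C_{\pi,i}$ is a subsequence of the sequence $\big(\max(b_{\pi,i-1,j})\big)_{j}$, where $j$ runs in increasing order over those indices $1\le j\le |C_{\pi,i-1}|$ for which $b_{\pi,i-1,j}$ is nonempty.
   Context: A "permutation" may be any finite sequence of distinct integers. West's stack-sorting map $s$: read the input left to right with an initially empty stack; repeatedly, if the input is nonempty and either the stack is empty or the top of the stack is greater than the next input entry, push the next entry; otherwise pop the top of the stack and append it to the output; stop when input and stack are empty. $\operatorname{sc}(\pi)$ is the least $k\ge0$ with $s^k(\pi)$ increasing. $S_n'$ is the set of permutations of $\{0,1,\dots,n\}$ whose last entry is $0$. For $\pi\in S_n'$ and $1\le i\le\operatorname{sc}(\pi)$ let $\sigma=s^{i-1}(\pi)$. Let $c_{\pi,i,1}$ be the maximum of the entries of $\sigma$ strictly left of $0$. For $j\ge2$, as long as there is at least one entry of $\sigma$ strictly between $c_{\pi,i,j-1}$ and $0$, let $c_{\pi,i,j}$ be the maximum of the entries strictly between $c_{\pi,i,j-1}$ and $0$; otherwise the sequence stops. This gives $C_{\pi,i}=(c_{\pi,i,1},\dots,c_{\pi,i,k})$. Blocks: $b_{\pi,i,1}$ is the (possibly empty) contiguous subsequence of $\sigma$ strictly before $c_{\pi,i,1}$, and for $2\le j\le k$, $b_{\pi,i,j}$ is the (possibly empty) contiguous subsequence of $\sigma$ strictly between $c_{\pi,i,j-1}$ and $c_{\pi,i,j}$. -}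

module Defs where

open import Data.Nat using (ℕ; zero; suc; _⊔_; _<ᵇ_; _<_; _≡ᵇ_)
open import Data.Bool using (Bool; true; false; if_then_else_)
open import Data.List using (List; []; _∷_; _++_; [_]; length; foldr; map)
open import Data.Product using (_×_; _,_; proj₁; proj₂)
open import Data.List.Relation.Unary.Linked using (Linked)

-- maximum of a list of naturals (only used on nonempty lists, where it is the true maximum)
maxL : List ℕ → ℕ
maxL = foldr _⊔_ 0

-- West's stack-sorting map, implemented literally as the stack algorithm.
-- State: remaining input, stack (head = top), output so far.

popWhile : ℕ → List ℕ → List ℕ → List ℕ × List ℕ
popWhile x []       out = [] , out
popWhile x (t ∷ st) out =
  if x <ᵇ t then (t ∷ st , out) else popWhile x st (out ++ [ t ])

popAll : List ℕ → List ℕ → List ℕ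
popAll []       out = out
popAll (t ∷ st) out = popAll st (out ++ [ t ])

run : List ℕ → List ℕ → List ℕ → List ℕ
run []       st out = popAll st out
run (x ∷ xs) st out with popWhile x st out
... | st' , out' = run xs (x ∷ st') out'

s : List ℕ → List ℕ
s π = run π [] []

iter : ℕ → (List ℕ → List ℕ) → List ℕ → List ℕ
iter zero    f x = x
iter (suc k) f x = f (iter k f x)

Increasing : List ℕ → Set
Increasing = Linked _<_

IsSc : List ℕ → ℕ → Set
IsSc π k = Increasing (iter k s π) × (∀ m → m < k → Increasing (iter m s π) → Data.Empty.⊥)
  where import Data.Empty

open import Data.List using (upTo)
open import Data.List.Relation.Binary.Permutation.Propositional using (_↭_)
open import Relation.Binary.PropositionalEquality using (_≡_)
open import Data.Product using (Σ; ∃)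

InS' : ℕ → List ℕ → Set
InS' n π = (π ↭ upTo (suc n)) × ∃ λ τ → π ≡ τ ++ [ 0 ]

breakAt : ℕ → List ℕ → List ℕ × List ℕ
breakAt v [] = [] , []
breakAt v (x ∷ xs) with x ≡ᵇ v
... | true  = [] , xs
... | false with breakAt v xs
...   | (b , a) = x ∷ b , a

-- Given the list L of entries strictly between the previous c (or the start) and 0,
-- produce the pairs (b_j , c_j): c = max L, b = entries of L before c, then recurse
-- on the entries of L after c.  The fuel argument (≥ length L suffices, since
-- the list strictly shrinks) only serves termination.
decompF : ℕ → List ℕ → List (List ℕ × ℕ)
decompF zero     L        = []
decompF (suc f)  []       = []
decompF (suc f)  (x ∷ xs) with breakAt (maxL (x ∷ xs)) (x ∷ xs)
... | (b , a) = (b , maxL (x ∷ xs)) ∷ decompF f a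

decomp : List ℕ → List (List ℕ × ℕ)
decomp σ = decompF (length σ) (proj₁ (breakAt 0 σ))

Cseq : List ℕ → ℕ → List ℕ
Cseq π i = map proj₂ (decomp (iter (i Data.Nat.∸ 1) s π))

blockMaxes : List (List ℕ × ℕ) → List ℕ
blockMaxes [] = []
blockMaxes (([] , c) ∷ rest) = blockMaxes rest
blockMaxes ((b@(_ ∷ _) , c) ∷ rest) = maxL b ∷ blockMaxes rest

Bmax : List ℕ → ℕ → List ℕ
Bmax π i = blockMaxes (decomp (iter (i Data.Nat.∸ 1) s π))

{-# OPTIONS --safe #-}
module Submission where

open import Defs
open import Data.Nat using (ℕ; _≤_; _∸_)
open import Data.List using (List)
open import Data.List.Relation.Binary.Sublist.Propositional using (_⊆_)

open import Data.Nat using (zero; suc; _<_; _<ᵇ_; _≡ᵇ_; z≤n; s≤s)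
open import Data.Nat.Properties
  using (≤-trans; ≤-antisym; ≤-pred; m≤m⊔n; m≤n⊔m; m≤n+m; ⊔-sel; ⊔-identityʳ;
         ≤∧≢⇒<; <⇒≱; n≢0⇒n>0; ≡ᵇ⇒≡; ≡⇒≡ᵇ; <ᵇ⇒<; <⇒<ᵇ)
open import Data.Bool using (true; false)
open import Data.List using ([]; _∷_; _++_; [_]; length; map; concatMap)
open import Data.List.Properties using (++-assoc; ++-identityʳ; length-++)
open import Data.List.Relation.Unary.All as All using (All; []; _∷_)
import Data.List.Relation.Unary.All.Properties as All
open import Data.List.Relation.Unary.AllPairs as AllPairs using ([]; _∷_)
open import Data.List.Relation.Unary.Unique.Propositional using (Unique)
open import Data.List.Relation.Unary.Unique.Propositional.Properties using (upTo⁺)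
open import Data.List.Relation.Unary.Any using (here; there)
open import Data.List.Membership.Propositional using (_∈_)
open import Data.List.Membership.Propositional.Properties using (∈-++⁺ˡ; ∈-++⁺ʳ; ∈-++⁻)
open import Data.List.Relation.Binary.Permutation.Propositional
  using (_↭_; ↭-sym; ↭-trans; ↭-reflexive; ↭⇒↭ₛ; module PermutationReasoning)
open import Data.List.Relation.Binary.Permutation.Propositional.Properties
  using (All-resp-↭; ∈-resp-↭; ++⁺ˡ; shift)
import Data.List.Relation.Binary.Permutation.Setoid.Properties as Permutationₛ
open import Data.List.Relation.Binary.Sublist.Propositional
  using (_∷_; _∷ʳ_; ⊆-refl; ⊆-trans; minimum)
open import Data.Product using (∃-syntax; _×_; _,_; proj₁; proj₂; map₁; map₂; uncurry)
open import Data.Sum using (inj₁; inj₂)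
open import Data.Empty using (⊥-elim)
open import Function using (_∘_)
open import Relation.Binary.PropositionalEquality
  using (_≡_; _≢_; refl; sym; trans; cong; subst; ≢-sym; setoid; module ≡-Reasoning)

-- Write the part of σ before 0 as b₁ c₁ b₂ c₂ … b_k c_k.  Each c_j exceeds every later
-- entry before 0, so reading it empties the stack, emitting s(b_j), after which c_j stays
-- in the stack below everything read later; 0 lands on top of c_k … c₁ and is popped at the
-- next step.  Hence s(σ) = s(b₁) s(b₂) … s(b_k) 0 ….  As s(b) ends with max b, the maximum
-- of a suffix of s(b₁) … s(b_k) starting at a block boundary is max b_j for some nonempty
-- b_j, and what follows it starts at a block boundary again; so the chain C of s(σ) runs
-- through a subsequence of the maxima of the nonempty blocks b_j.

unique-++⁻ˡ : ∀ (xs : List ℕ) {ys} → Unique (xs ++ ys) → Unique xs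
unique-++⁻ˡ []       _         = []
unique-++⁻ˡ (x ∷ xs) (x∉ ∷ u) = All.++⁻ˡ xs x∉ ∷ unique-++⁻ˡ xs u

unique-++⁻ʳ : ∀ (xs : List ℕ) {ys} → Unique (xs ++ ys) → Unique ys
unique-++⁻ʳ []       u       = u
unique-++⁻ʳ (x ∷ xs) (_ ∷ u) = unique-++⁻ʳ xs u

unique-++⁻-disjoint : ∀ (xs : List ℕ) {ys v} → Unique (xs ++ ys) → v ∈ ys → All (v ≢_) xs
unique-++⁻-disjoint []       _        _  = []
unique-++⁻-disjoint (x ∷ xs) (x∉ ∷ u) v∈ =
  ≢-sym (All.lookup (All.++⁻ʳ xs x∉) v∈) ∷ unique-++⁻-disjoint xs u v∈

unique-resp-↭ : ∀ {xs ys : List ℕ} → xs ↭ ys → Unique xs → Unique ys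
unique-resp-↭ p = Permutationₛ.Unique-resp-↭ (setoid ℕ) (↭⇒↭ₛ p)

maxL-upper : ∀ xs → All (_≤ maxL xs) xs
maxL-upper []       = []
maxL-upper (x ∷ xs) =
  m≤m⊔n x (maxL xs) ∷ All.map (λ y≤ → ≤-trans y≤ (m≤n⊔m x (maxL xs))) (maxL-upper xs)

maxL-∈ : ∀ x xs → maxL (x ∷ xs) ∈ x ∷ xs
maxL-∈ x []       = here (⊔-identityʳ x)
maxL-∈ x (y ∷ ys) with ⊔-sel x (maxL (y ∷ ys))
... | inj₁ max≡x = here max≡x
... | inj₂ max≡m = there (subst (_∈ y ∷ ys) (sym max≡m) (maxL-∈ y ys))

breakAt-before : ∀ v xs → All (v ≢_) (proj₁ (breakAt v xs))
breakAt-before v []       = []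
breakAt-before v (x ∷ xs) with x ≡ᵇ v | ≡⇒≡ᵇ x v
... | true  | _   = []
... | false | x≢v = (x≢v ∘ sym) ∷ breakAt-before v xs

breakAt-split : ∀ {v xs} → v ∈ xs → xs ≡ proj₁ (breakAt v xs) ++ v ∷ proj₂ (breakAt v xs)
breakAt-split {v} {x ∷ xs} v∈ with x ≡ᵇ v | ≡ᵇ⇒≡ x v | ≡⇒≡ᵇ x v | v∈
... | true  | x≡v | _   | _         = cong (_∷ xs) (x≡v _)
... | false | _   | x≢v | here v≡x  = ⊥-elim (x≢v (sym v≡x))
... | false | _   | _   | there v∈′ = cong (x ∷_) (breakAt-split v∈′)

breakAt-head : ∀ v xs → breakAt v (v ∷ xs) ≡ ([] , xs)
breakAt-head v xs with v ≡ᵇ v | ≡⇒≡ᵇ v v refl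
... | true | _ = refl

breakAt-++ : ∀ {v} P Q → All (v ≢_) P → breakAt v (P ++ Q) ≡ map₁ (P ++_) (breakAt v Q)
breakAt-++         []      Q []           = refl
breakAt-++ {v} (x ∷ P) Q (v≢x ∷ v∉P) with x ≡ᵇ v | ≡ᵇ⇒≡ x v
... | true  | x≡v = ⊥-elim (v≢x (sym (x≡v _)))
... | false | _   rewrite breakAt-++ P Q v∉P = refl

breakAt-++-∷ : ∀ {v} P Q → All (v ≢_) P → breakAt v (P ++ v ∷ Q) ≡ (P , Q)
breakAt-++-∷ {v} P Q v∉P = begin
  breakAt v (P ++ v ∷ Q)            ≡⟨ breakAt-++ P (v ∷ Q) v∉P ⟩
  map₁ (P ++_) (breakAt v (v ∷ Q))  ≡⟨ cong (map₁ (P ++_)) (breakAt-head v Q) ⟩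
  (P ++ [] , Q)                     ≡⟨ cong (_, Q) (++-identityʳ P) ⟩
  (P , Q)                           ∎
  where open ≡-Reasoning

length-breakAt : ∀ v xs → length (proj₁ (breakAt v xs)) ≤ length xs
length-breakAt v []       = z≤n
length-breakAt v (x ∷ xs) with x ≡ᵇ v
... | true  = z≤n
... | false = s≤s (length-breakAt v xs)

feed : List ℕ → List ℕ → List ℕ → List ℕ × List ℕ
feed []       st o = st , o
feed (x ∷ xs) st o = feed xs (x ∷ proj₁ (popWhile x st o)) (proj₂ (popWhile x st o))

flush : List ℕ × List ℕ → List ℕ
flush (st , o) = o ++ st

popAll-flush : ∀ st o → popAll st o ≡ flush (st , o)
popAll-flush []       o = sym (++-identityʳ o)
popAll-flush (t ∷ st) o = trans (popAll-flush st (o ++ [ t ])) (++-assoc o [ t ] st)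

run≡flush∘feed : ∀ xs st o → run xs st o ≡ flush (feed xs st o)
run≡flush∘feed []       st o = popAll-flush st o
run≡flush∘feed (x ∷ xs) st o = run≡flush∘feed xs _ _

s≡flush∘feed : ∀ xs → s xs ≡ flush (feed xs [] [])
s≡flush∘feed xs = run≡flush∘feed xs [] []

feed-++ : ∀ xs ys st o → feed (xs ++ ys) st o ≡ uncurry (feed ys) (feed xs st o)
feed-++ []       ys st o = refl
feed-++ (x ∷ xs) ys st o = feed-++ xs ys _ _

popWhile-output : ∀ x st o p → popWhile x st (o ++ p) ≡ map₂ (o ++_) (popWhile x st p)
popWhile-output x []       o p = refl
popWhile-output x (t ∷ st) o p with x <ᵇ t
... | true  = refl
... | false = trans (cong (popWhile x st) (++-assoc o p [ t ]))
                    (popWhile-output x st o (p ++ [ t ]))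

feed-output : ∀ xs st o p → feed xs st (o ++ p) ≡ map₂ (o ++_) (feed xs st p)
feed-output []       st o p = refl
feed-output (x ∷ xs) st o p rewrite popWhile-output x st o p = feed-output xs _ o _

flush-feed-output : ∀ xs st o → flush (feed xs st o) ≡ o ++ flush (feed xs st [])
flush-feed-output xs st o = begin
  flush (feed xs st o)                  ≡⟨ cong (flush ∘ feed xs st) (sym (++-identityʳ o)) ⟩
  flush (feed xs st (o ++ []))          ≡⟨ cong flush (feed-output xs st o []) ⟩
  flush (map₂ (o ++_) (feed xs st []))  ≡⟨ ++-assoc o _ _ ⟩
  o ++ flush (feed xs st [])            ∎
  where open ≡-Reasoning

popWhile-flush : ∀ x st o → flush (popWhile x st o) ≡ flush (st , o)
popWhile-flush x []       o = refl
popWhile-flush x (t ∷ st) o with x <ᵇ t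
... | true  = refl
... | false = trans (popWhile-flush x st (o ++ [ t ])) (++-assoc o [ t ] st)

flush-feed-↭ : ∀ xs st o → flush (feed xs st o) ↭ o ++ st ++ xs
flush-feed-↭ []       st o = ↭-reflexive (cong (o ++_) (sym (++-identityʳ st)))
flush-feed-↭ (x ∷ xs) st o = begin
  flush (feed xs (x ∷ st′) o′)  ↭⟨ flush-feed-↭ xs (x ∷ st′) o′ ⟩
  o′ ++ x ∷ st′ ++ xs           ↭⟨ ++⁺ˡ o′ (shift x st′ xs) ⟨
  o′ ++ st′ ++ x ∷ xs           ≡⟨ ++-assoc o′ st′ (x ∷ xs) ⟨
  flush (st′ , o′) ++ x ∷ xs    ≡⟨ cong (_++ x ∷ xs) (popWhile-flush x st o) ⟩
  (o ++ st) ++ x ∷ xs           ≡⟨ ++-assoc o st (x ∷ xs) ⟩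
  o ++ st ++ x ∷ xs             ∎
  where
  open PermutationReasoning
  st′ o′ : List ℕ
  st′ = proj₁ (popWhile x st o)
  o′  = proj₂ (popWhile x st o)

s-↭ : ∀ xs → s xs ↭ xs
s-↭ xs = subst (_↭ xs) (sym (s≡flush∘feed xs)) (flush-feed-↭ xs [] [])

iter-s-↭ : ∀ j xs → iter j s xs ↭ xs
iter-s-↭ zero    xs = ↭-reflexive refl
iter-s-↭ (suc j) xs = ↭-trans (s-↭ (iter j s xs)) (iter-s-↭ j xs)

popWhile-stack-All : ∀ {P : ℕ → Set} x st o → All P st → All P (proj₁ (popWhile x st o))
popWhile-stack-All x []       o []         = []
popWhile-stack-All x (t ∷ st) o (pt ∷ pst) with x <ᵇ t
... | true  = pt ∷ pst
... | false = popWhile-stack-All x st (o ++ [ t ]) pst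

feed-stack-All : ∀ {P : ℕ → Set} xs st o → All P st → All P xs → All P (proj₁ (feed xs st o))
feed-stack-All []       st o pst []         = pst
feed-stack-All (x ∷ xs) st o pst (px ∷ pxs) =
  feed-stack-All xs _ _ (px ∷ popWhile-stack-All x st o pst) pxs

popWhile-under : ∀ {x} st o → All (x <_) st → popWhile x st o ≡ (st , o)
popWhile-under         []       o []        = refl
popWhile-under {x} (t ∷ st) o (x<t ∷ _) with x <ᵇ t | <⇒<ᵇ x<t
... | true | _ = refl

popWhile-empties : ∀ {x} st o → All (_≤ x) st → popWhile x st o ≡ ([] , flush (st , o))
popWhile-empties         []       o []           = cong ([] ,_) (sym (++-identityʳ o))
popWhile-empties {x} (t ∷ st) o (t≤x ∷ st≤x) with x <ᵇ t | <ᵇ⇒< x t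
... | true  | x<t = ⊥-elim (<⇒≱ (x<t _) t≤x)
... | false | _   = trans (popWhile-empties st (o ++ [ t ]) st≤x)
                          (cong ([] ,_) (++-assoc o [ t ] st))

popWhile-barrier : ∀ {x m} st o → x < m →
  popWhile x (st ++ [ m ]) o ≡ map₁ (_++ [ m ]) (popWhile x st o)
popWhile-barrier {x} {m} [] o x<m with x <ᵇ m | <⇒<ᵇ x<m
... | true | _ = refl
popWhile-barrier {x} (t ∷ st) o x<m with x <ᵇ t
... | true  = refl
... | false = popWhile-barrier st (o ++ [ t ]) x<m

feed-barrier : ∀ {m} xs st o → All (_< m) xs →
  feed xs (st ++ [ m ]) o ≡ map₁ (_++ [ m ]) (feed xs st o)
feed-barrier []       st o []           = refl
feed-barrier (x ∷ xs) st o (x<m ∷ xs<m) rewrite popWhile-barrier st o x<m =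
  feed-barrier xs _ _ xs<m

feed-through-max : ∀ {m} b a o → All (_≤ m) b → All (_< m) a →
  feed (b ++ m ∷ a) [] o ≡ map₁ (_++ [ m ]) (feed a [] (o ++ s b))
feed-through-max {m} b a o b≤m a<m = begin
  feed (b ++ m ∷ a) [] o
    ≡⟨ feed-++ b (m ∷ a) [] o ⟩
  feed a (m ∷ proj₁ (popWhile m st o′)) (proj₂ (popWhile m st o′))
    ≡⟨ cong (λ q → feed a (m ∷ proj₁ q) (proj₂ q)) (popWhile-empties st o′ st≤m) ⟩
  feed a [ m ] (flush (feed b [] o))
    ≡⟨ cong (feed a [ m ]) (flush-feed-output b [] o) ⟩
  feed a [ m ] (o ++ flush (feed b [] []))
    ≡⟨ cong (feed a [ m ] ∘ (o ++_)) (s≡flush∘feed b) ⟨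
  feed a [ m ] (o ++ s b)
    ≡⟨ feed-barrier a [] (o ++ s b) a<m ⟩
  map₁ (_++ [ m ]) (feed a [] (o ++ s b))
    ∎
  where
  open ≡-Reasoning
  st o′ : List ℕ
  st = proj₁ (feed b [] o)
  o′ = proj₂ (feed b [] o)
  st≤m : All (_≤ m) st
  st≤m = feed-stack-All b [] o [] b≤m

s-max-split : ∀ {m} b a → All (_≤ m) b → All (_< m) a →
  s (b ++ m ∷ a) ≡ s b ++ s a ++ [ m ]
s-max-split {m} b a b≤m a<m = begin
  s (b ++ m ∷ a)
    ≡⟨ s≡flush∘feed (b ++ m ∷ a) ⟩
  flush (feed (b ++ m ∷ a) [] [])
    ≡⟨ cong flush (feed-through-max b a [] b≤m a<m) ⟩
  flush (map₁ (_++ [ m ]) (feed a [] (s b)))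
    ≡⟨ ++-assoc (proj₂ (feed a [] (s b))) _ [ m ] ⟨
  flush (feed a [] (s b)) ++ [ m ]
    ≡⟨ cong (_++ [ m ]) (flush-feed-output a [] (s b)) ⟩
  (s b ++ flush (feed a [] [])) ++ [ m ]
    ≡⟨ cong (λ z → (s b ++ z) ++ [ m ]) (s≡flush∘feed a) ⟨
  (s b ++ s a) ++ [ m ]
    ≡⟨ ++-assoc (s b) (s a) [ m ] ⟩
  s b ++ s a ++ [ m ]
    ∎
  where open ≡-Reasoning

flush-feed-0-on-top : ∀ xs st → ∃[ Z ] flush (feed xs (0 ∷ st) []) ≡ 0 ∷ Z
flush-feed-0-on-top []       st = st , refl
flush-feed-0-on-top (y ∷ ys) st = proj₂ (popWhile y st []) ++ rest , (begin
  flush (feed ys (y ∷ st′) o′)          ≡⟨ flush-feed-output ys (y ∷ st′) o′ ⟩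
  o′ ++ rest                            ≡⟨ cong ((_++ rest) ∘ proj₂) (popWhile-output y st [ 0 ] []) ⟩
  0 ∷ proj₂ (popWhile y st []) ++ rest  ∎)
  where
  open ≡-Reasoning
  st′ o′ rest : List ℕ
  st′  = proj₁ (popWhile y st [ 0 ])
  o′   = proj₂ (popWhile y st [ 0 ])
  rest = flush (feed ys (y ∷ st′) [])

s-split-at-0 : ∀ {σ} → 0 ∈ σ →
  ∃[ Z ] s σ ≡ proj₂ (feed (proj₁ (breakAt 0 σ)) [] []) ++ 0 ∷ Z
s-split-at-0 {σ} 0∈σ = proj₁ (flush-feed-0-on-top R st) , (begin
  s σ
    ≡⟨ s≡flush∘feed σ ⟩
  flush (feed σ [] [])
    ≡⟨ cong (λ xs → flush (feed xs [] [])) (breakAt-split 0∈σ) ⟩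
  flush (feed (L ++ 0 ∷ R) [] [])
    ≡⟨ cong flush (feed-++ L (0 ∷ R) [] []) ⟩
  flush (feed R (0 ∷ proj₁ (popWhile 0 st o)) (proj₂ (popWhile 0 st o)))
    ≡⟨ cong (λ q → flush (feed R (0 ∷ proj₁ q) (proj₂ q))) (popWhile-under st o 0<st) ⟩
  flush (feed R (0 ∷ st) o)
    ≡⟨ flush-feed-output R (0 ∷ st) o ⟩
  o ++ flush (feed R (0 ∷ st) [])
    ≡⟨ cong (o ++_) (proj₂ (flush-feed-0-on-top R st)) ⟩
  o ++ 0 ∷ proj₁ (flush-feed-0-on-top R st)
    ∎)
  where
  open ≡-Reasoning
  L R st o : List ℕ
  L  = proj₁ (breakAt 0 σ)
  R  = proj₂ (breakAt 0 σ)
  st = proj₁ (feed L [] [])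
  o  = proj₂ (feed L [] [])
  0<st : All (0 <_) st
  0<st = feed-stack-All L [] [] [] (All.map (n≢0⇒n>0 ∘ ≢-sym) (breakAt-before 0 σ))

module MaxSplit {x : ℕ} {xs : List ℕ} (u : Unique (x ∷ xs)) where

  m : ℕ
  m = maxL (x ∷ xs)

  before after : List ℕ
  before = proj₁ (breakAt m (x ∷ xs))
  after  = proj₂ (breakAt m (x ∷ xs))

  m∈ : m ∈ x ∷ xs
  m∈ = maxL-∈ x xs

  ≤m : All (_≤ m) (x ∷ xs)
  ≤m = maxL-upper (x ∷ xs)

  split : x ∷ xs ≡ before ++ m ∷ after
  split = breakAt-split m∈

  private
    m∷after-unique : Unique (m ∷ after)
    m∷after-unique = unique-++⁻ʳ before (subst Unique split u)

    ≤m-split : All (_≤ m) (before ++ m ∷ after)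
    ≤m-split = subst (All (_≤ m)) split ≤m

  before≤m : All (_≤ m) before
  before≤m = All.++⁻ˡ before ≤m-split

  after<m : All (_< m) after
  after<m = All.zipWith (λ (y≤m , m≢y) → ≤∧≢⇒< y≤m (≢-sym m≢y))
                        (All.tail (All.++⁻ʳ before ≤m-split) , AllPairs.head m∷after-unique)

  after-unique : Unique after
  after-unique = AllPairs.tail m∷after-unique

  after-shorter : length after < length (x ∷ xs)
  after-shorter = subst (λ l → length after < length l) (sym split)
    (subst (length after <_) (sym (length-++ before)) (m≤n+m _ (length before)))

s-ends-with-max : ∀ {x xs} → Unique (x ∷ xs) →
  ∃[ T ] s (x ∷ xs) ≡ T ++ [ maxL (x ∷ xs) ]
s-ends-with-max {x} {xs} u = s before ++ s after , (begin
  s (x ∷ xs)                      ≡⟨ cong s split ⟩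
  s (before ++ m ∷ after)         ≡⟨ s-max-split before after before≤m after<m ⟩
  s before ++ s after ++ [ m ]    ≡⟨ ++-assoc (s before) (s after) [ m ] ⟨
  (s before ++ s after) ++ [ m ]  ∎)
  where
  open MaxSplit u
  open ≡-Reasoning

stackSortedBlocks : List (List ℕ × ℕ) → List ℕ
stackSortedBlocks = concatMap (s ∘ proj₁)

feed-output-decompF : ∀ f L o → Unique L → length L ≤ f →
  proj₂ (feed L [] o) ≡ o ++ stackSortedBlocks (decompF f L)
feed-output-decompF zero    []       o _ _   = sym (++-identityʳ o)
feed-output-decompF (suc f) []       o _ _   = sym (++-identityʳ o)
feed-output-decompF (suc f) (x ∷ xs) o u len = begin
  proj₂ (feed (x ∷ xs) [] o)
    ≡⟨ cong (λ L → proj₂ (feed L [] o)) split ⟩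
  proj₂ (feed (before ++ m ∷ after) [] o)
    ≡⟨ cong proj₂ (feed-through-max before after o before≤m after<m) ⟩
  proj₂ (feed after [] (o ++ s before))
    ≡⟨ feed-output-decompF f after _ after-unique (≤-pred (≤-trans after-shorter len)) ⟩
  (o ++ s before) ++ stackSortedBlocks (decompF f after)
    ≡⟨ ++-assoc o (s before) _ ⟩
  o ++ s before ++ stackSortedBlocks (decompF f after)
    ∎
  where
  open MaxSplit u
  open ≡-Reasoning

max-in-stackSorted-block : ∀ y ys {m} rest → m ∈ s (y ∷ ys) →
  All (_≤ m) (s (y ∷ ys) ++ rest) → Unique (s (y ∷ ys) ++ rest) →
  m ≡ maxL (y ∷ ys) × proj₂ (breakAt m (s (y ∷ ys) ++ rest)) ≡ rest
max-in-stackSorted-block y ys {m} rest m∈sb ≤m u = m≡maxb , (begin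
  proj₂ (breakAt m (s b ++ rest))    ≡⟨ cong (proj₂ ∘ breakAt m) sb++rest≡ ⟩
  proj₂ (breakAt m (T ++ m ∷ rest))  ≡⟨ cong proj₂ (breakAt-++-∷ T rest m∉T) ⟩
  rest                               ∎)
  where
  open ≡-Reasoning
  b : List ℕ
  b = y ∷ ys
  ends-with-max : ∃[ T ] s b ≡ T ++ [ maxL b ]
  ends-with-max = s-ends-with-max (unique-resp-↭ (s-↭ b) (unique-++⁻ˡ (s b) u))
  T : List ℕ
  T = proj₁ ends-with-max
  maxb∈sb : maxL b ∈ s b
  maxb∈sb = subst (maxL b ∈_) (sym (proj₂ ends-with-max)) (∈-++⁺ʳ T (here refl))
  m≡maxb : m ≡ maxL b
  m≡maxb = ≤-antisym (All.lookup (All-resp-↭ (↭-sym (s-↭ b)) (maxL-upper b)) m∈sb)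
                     (All.lookup ≤m (∈-++⁺ˡ maxb∈sb))
  sb++rest≡ : s b ++ rest ≡ T ++ m ∷ rest
  sb++rest≡ = begin
    s b ++ rest                ≡⟨ cong (_++ rest) (proj₂ ends-with-max) ⟩
    (T ++ [ maxL b ]) ++ rest  ≡⟨ ++-assoc T [ maxL b ] rest ⟩
    T ++ maxL b ∷ rest         ≡⟨ cong (λ z → T ++ z ∷ rest) m≡maxb ⟨
    T ++ m ∷ rest              ∎
  m∉T : All (m ≢_) T
  m∉T = unique-++⁻-disjoint T (subst Unique sb++rest≡ u) (here refl)

after-max-stackSortedBlocks : ∀ D {m} → m ∈ stackSortedBlocks D →
  All (_≤ m) (stackSortedBlocks D) → Unique (stackSortedBlocks D) →
  ∃[ D′ ] proj₂ (breakAt m (stackSortedBlocks D)) ≡ stackSortedBlocks D′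
        × m ∷ blockMaxes D′ ⊆ blockMaxes D
after-max-stackSortedBlocks [] ()
after-max-stackSortedBlocks (([] , _) ∷ D) m∈ ≤m u = after-max-stackSortedBlocks D m∈ ≤m u
after-max-stackSortedBlocks ((b@(y ∷ ys) , _) ∷ D) m∈ ≤m u with ∈-++⁻ (s b) m∈
... | inj₁ m∈sb =
  let m≡maxb , after≡ = max-in-stackSorted-block y ys (stackSortedBlocks D) m∈sb ≤m u
  in  D , after≡ , m≡maxb ∷ ⊆-refl
... | inj₂ m∈rest =
  let D′ , after≡ , sub =
        after-max-stackSortedBlocks D m∈rest (All.++⁻ʳ (s b) ≤m) (unique-++⁻ʳ (s b) u)
      m∉sb = unique-++⁻-disjoint (s b) u m∈rest
  in  D′ , trans (cong proj₂ (breakAt-++ (s b) _ m∉sb)) after≡ , maxL b ∷ʳ sub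

cs-stackSortedBlocks⊆blockMaxes : ∀ f X D → X ≡ stackSortedBlocks D →
  Unique X → length X ≤ f → map proj₂ (decompF f X) ⊆ blockMaxes D
cs-stackSortedBlocks⊆blockMaxes zero    X        D _  _ _   = minimum _
cs-stackSortedBlocks⊆blockMaxes (suc f) []       D _  _ _   = minimum _
cs-stackSortedBlocks⊆blockMaxes (suc f) (x ∷ xs) D X≡ u len =
  let D′ , after≡ , sub = after-max-stackSortedBlocks D
        (subst (m ∈_) X≡ m∈) (subst (All (_≤ m)) X≡ ≤m) (subst Unique X≡ u)
  in  ⊆-trans (refl ∷ cs-stackSortedBlocks⊆blockMaxes f after D′
                        (trans (cong (proj₂ ∘ breakAt m) X≡) after≡)
                        after-unique (≤-pred (≤-trans after-shorter len)))
              sub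
  where open MaxSplit u

cs-of-s⊆blockMaxes : ∀ σ → Unique σ → 0 ∈ σ →
  map proj₂ (decomp (s σ)) ⊆ blockMaxes (decomp σ)
cs-of-s⊆blockMaxes σ u 0∈σ =
  cs-stackSortedBlocks⊆blockMaxes (length (s σ)) _ (decompF (length σ) L) X≡ X-unique
                                  (length-breakAt 0 (s σ))
  where
  L O Z : List ℕ
  L = proj₁ (breakAt 0 σ)
  O = proj₂ (feed L [] [])
  Z = proj₁ (s-split-at-0 0∈σ)
  s≡ : s σ ≡ O ++ 0 ∷ Z
  s≡ = proj₂ (s-split-at-0 0∈σ)
  O++0∷Z-unique : Unique (O ++ 0 ∷ Z)
  O++0∷Z-unique = subst Unique s≡ (unique-resp-↭ (↭-sym (s-↭ σ)) u)
  X≡O : proj₁ (breakAt 0 (s σ)) ≡ O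
  X≡O = cong proj₁ (trans (cong (breakAt 0) s≡)
                          (breakAt-++-∷ O Z (unique-++⁻-disjoint O O++0∷Z-unique (here refl))))
  L-unique : Unique L
  L-unique = unique-++⁻ˡ L (subst Unique (breakAt-split 0∈σ) u)
  X≡ : proj₁ (breakAt 0 (s σ)) ≡ stackSortedBlocks (decompF (length σ) L)
  X≡ = trans X≡O (feed-output-decompF (length σ) L [] L-unique (length-breakAt 0 σ))
  X-unique : Unique (proj₁ (breakAt 0 (s σ)))
  X-unique = subst Unique (sym X≡O) (unique-++⁻ˡ O O++0∷Z-unique)

corollary3p6 : (n : ℕ) (π : List ℕ) → InS' n π →
    (k : ℕ) → IsSc π k →
    (i : ℕ) → 2 ≤ i → i ≤ k →
    Cseq π i ⊆ Bmax π (i ∸ 1)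
corollary3p6 _ _ _ _ _ (suc zero) (s≤s ()) _
corollary3p6 n π (π↭ , τ , π≡τ++0) _ _ (suc (suc j)) _ _ =
  cs-of-s⊆blockMaxes (iter j s π) (unique-resp-↭ π↭σ π-unique) (∈-resp-↭ π↭σ 0∈π)
  where
  π↭σ : π ↭ iter j s π
  π↭σ = ↭-sym (iter-s-↭ j π)
  π-unique : Unique π
  π-unique = unique-resp-↭ (↭-sym π↭) (upTo⁺ (suc n))
  0∈π : 0 ∈ π
  0∈π = subst (0 ∈_) (sym π≡τ++0) (∈-++⁺ʳ τ (here refl))
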